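{- Let $n$ be a nonnegative integer and let $c^1\to c^2\to\dots\to c^k$ be a sequence of PSSPM steps with all $c^t\in\mathrm{PSSPM}(n)$. Suppose there is a column $i$ satisfying the following two conditions. 1. For all $1\le t\le k$, $c^t_i=\max_j c^t_j$. 2. $c^1_i\le c^1_{i+1}+2$ (resp. $c^1_{i-1}+2\ge c^1_i$). Then for all $1\le t\le k$, $c^t_i\le c^t_{i+1}+2$ (resp. $c^t_{i-1}+2\ge c^t_i$).
   Context: A configuration is a sequence $c=(c_i)_{i\in\mathbb Z}$ of nonnegative integers with only finitely many nonzero terms. The initial configuration $(\underline{n})$ is given by $c_0=n$ and $c_i=0$ otherwise. There are two local rules. - Rule $\mathcal L$ at column $i$ is applicable when $a_{i-1}+2\le a_i$. It decreases $a_i$ by 1 and increases $a_{i-1}$ by 1. - Rule $\mathcal R$ at column $i$ is applicable when $a_i\ge a_{i+1}+2$. It decreases $a_i$ by 1 and increases $a_{i+1}$ by 1. One PSSPM step, written $a\to b$, applies simultaneously, at every column where at least one local rule is applicable, exactly one applicable local rule. Where both are applicable, either may be chosen. PSSPM($n$) is the set of configurations reachable from $(\underline{n})$ by finitely many PSSPM steps. -}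

module Defs where

open import Data.Nat using (ℕ; _+_; _≤_)
open import Data.Integer using (ℤ; +_) renaming (_+_ to _+ℤ_; _-_ to _-ℤ_)
open import Data.Product using (_×_; ∃)
open import Data.Empty using (⊥)
open import Relation.Nullary using (¬_)
open import Relation.Binary.PropositionalEquality using (_≡_)

-- A configuration: column ↦ number of grains.  (Finite support is automatic
-- for everything reachable from the initial configuration.)
Config : Set
Config = ℤ → ℕ

initial : ℕ → Config
initial n (+ 0) = n
initial n _     = 0

LApp : Config → ℤ → Set
LApp a i = a (i -ℤ + 1) + 2 ≤ a i

RApp : Config → ℤ → Set
RApp a i = a (i +ℤ + 1) + 2 ≤ a i

data Choice : Set where
  none ruleL ruleR : Choice

-- a choice is admissible: a chosen rule must be applicable, and if no rule is
-- chosen then no rule is applicable (every column with an applicable rule fires)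
Admissible : Config → (ℤ → Choice) → Set
Admissible a σ = (i : ℤ) → Adm (σ i) i
  where
  Adm : Choice → ℤ → Set
  Adm none  i = ¬ LApp a i × ¬ RApp a i
  Adm ruleL i = LApp a i
  Adm ruleR i = RApp a i

fires : Choice → ℕ
fires none = 0
fires _    = 1

isL : Choice → ℕ
isL ruleL = 1
isL _     = 0

isR : Choice → ℕ
isR ruleR = 1
isR _     = 0

Step : Config → Config → Set
Step a b = ∃ λ (σ : ℤ → Choice) → Admissible a σ ×
  ((i : ℤ) → b i + fires (σ i) ≡ a i + isL (σ (i +ℤ + 1)) + isR (σ (i -ℤ + 1)))

data PSSPM (n : ℕ) : Config → Set where
  start : PSSPM n (initial n)
  next  : ∀ {a b} → PSSPM n a → Step a b → PSSPM n b

module Submission where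

-- Fix a column i holding a maximal pile throughout the run and a
-- neighbour j ∈ {i+1, i−1}.  The gap  c_i − c_j ≤ 2  is preserved by every
-- step a → b with i maximal in a:
--   * no neighbour can send a grain to i, since that would require the
--     neighbour to exceed a_i by 2; hence b_i = a_i − [i fires];
--   * every column loses at most one grain, so a_j ≤ b_j + 1;
--   * if the gap is strictly below 2 this already gives b_i ≤ b_j + 2, and if it
--     equals 2 then the rule towards j is applicable at i, so i fires and
--     b_i = a_i − 1 ≤ b_j + 2.
-- The file first records the integer bookkeeping for neighbouring columns, then
-- the two facts about a single step at a maximal column, then the arithmetic
-- combining them (gap-preserved-by-step), and finally a generic induction over
-- the time index of a finite run; lemma1 applies the latter to both neighbours.

open import Defs
open import Data.Nat using (ℕ; suc; _+_; _≤_; _<_; zero; s≤s; s≤s⁻¹; z≤n)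
open import Data.Nat.Properties
  using (≤-trans; ≤-reflexive; m≤m+n; +-monoʳ-≤; +-monoˡ-≤; +-cancelʳ-≤;
         +-identityʳ; +-assoc; +-suc; m+1+n≰m; m≤n⇒m<n∨m≡n; <-trans; n<1+n;
         module ≤-Reasoning)
open import Data.Integer using (ℤ; +_) renaming (_+_ to _+ℤ_; _-_ to _-ℤ_)
open import Data.Integer.Properties using (+-0-abelianGroup)
open import Algebra.Bundles using (AbelianGroup)
open import Algebra.Properties.Group (AbelianGroup.group +-0-abelianGroup)
  using (//-rightDividesˡ; //-rightDividesʳ)
open import Data.Product using (_×_; _,_)
open import Data.Sum using (_⊎_; inj₁; inj₂)
open import Data.Empty using (⊥-elim)
open import Relation.Nullary using (¬_)
open import Relation.Binary.PropositionalEquality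
  using (_≡_; refl; sym; trans; cong; cong₂; subst; module ≡-Reasoning)

right-left : ∀ i → (i +ℤ + 1) -ℤ + 1 ≡ i
right-left i = //-rightDividesʳ (+ 1) i

left-right : ∀ i → (i -ℤ + 1) +ℤ + 1 ≡ i
left-right i = //-rightDividesˡ (+ 1) i

not-two-above : ∀ {x y} → x ≤ y → ¬ (y + 2 ≤ x)
not-two-above {x} {y} x≤y y+2≤x = m+1+n≰m y (≤-trans y+2≤x x≤y)

fires≤1 : ∀ r → fires r ≤ 1
fires≤1 none  = z≤n
fires≤1 ruleL = s≤s z≤n
fires≤1 ruleR = s≤s z≤n

loses-at-most-one : ∀ {a b} → Step a b → ∀ j → a j ≤ b j + 1
loses-at-most-one {a} {b} (σ , _ , balance) j = begin
  a j                                               ≤⟨ m≤m+n (a j) _ ⟩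
  a j + isL (σ (j +ℤ + 1))                          ≤⟨ m≤m+n _ _ ⟩
  a j + isL (σ (j +ℤ + 1)) + isR (σ (j -ℤ + 1))     ≡⟨ balance j ⟨
  b j + fires (σ j)                                 ≤⟨ +-monoʳ-≤ (b j) (fires≤1 (σ j)) ⟩
  b j + 1                                           ∎
  where open ≤-Reasoning

module AtMaximum {a b : Config} {σ : ℤ → Choice} (adm : Admissible a σ)
  (balance : ∀ j → b j + fires (σ j) ≡ a j + isL (σ (j +ℤ + 1)) + isR (σ (j -ℤ + 1)))
  {i : ℤ} (maximal : ∀ j → a j ≤ a i) where

  -- The right neighbour cannot apply rule L: it would have to exceed a_i by 2.
  no-inflow-from-right : isL (σ (i +ℤ + 1)) ≡ 0
  no-inflow-from-right with σ (i +ℤ + 1) | adm (i +ℤ + 1)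
  ... | none  | _ = refl
  ... | ruleR | _ = refl
  ... | ruleL | applicable = ⊥-elim (not-two-above (maximal (i +ℤ + 1))
          (subst (λ z → a z + 2 ≤ a (i +ℤ + 1)) (right-left i) applicable))

  no-inflow-from-left : isR (σ (i -ℤ + 1)) ≡ 0
  no-inflow-from-left with σ (i -ℤ + 1) | adm (i -ℤ + 1)
  ... | none  | _ = refl
  ... | ruleL | _ = refl
  ... | ruleR | applicable = ⊥-elim (not-two-above (maximal (i -ℤ + 1))
          (subst (λ z → a z + 2 ≤ a (i -ℤ + 1)) (left-right i) applicable))

  balance-at-maximum : b i + fires (σ i) ≡ a i
  balance-at-maximum = begin
    b i + fires (σ i)                                 ≡⟨ balance i ⟩
    a i + isL (σ (i +ℤ + 1)) + isR (σ (i -ℤ + 1))     ≡⟨ cong₂ (λ x y → a i + x + y)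
                                                           no-inflow-from-right no-inflow-from-left ⟩
    a i + 0 + 0                                       ≡⟨ trans (+-identityʳ _) (+-identityʳ _) ⟩
    a i                                               ∎
    where open ≡-Reasoning

  fires-if-applicable : LApp a i ⊎ RApp a i → fires (σ i) ≡ 1
  fires-if-applicable applicable with σ i | adm i
  ... | ruleL | _ = refl
  ... | ruleR | _ = refl
  ... | none  | (no-L , no-R) with applicable
  ...   | inj₁ l = ⊥-elim (no-L l)
  ...   | inj₂ r = ⊥-elim (no-R r)

maximum-does-not-grow : ∀ {a b i} → Step a b → (∀ j → a j ≤ a i) → b i ≤ a i
maximum-does-not-grow {b = b} {i} (σ , adm , balance) maximal =
  ≤-trans (m≤m+n (b i) (fires (σ i))) (≤-reflexive (AtMaximum.balance-at-maximum adm balance maximal))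

maximum-loses-if-applicable : ∀ {a b i} → Step a b → (∀ j → a j ≤ a i) →
  LApp a i ⊎ RApp a i → b i + 1 ≡ a i
maximum-loses-if-applicable {a} {b} {i} (σ , adm , balance) maximal applicable = begin
  b i + 1            ≡⟨ cong (λ x → b i + x) (sym (fires-if-applicable applicable)) ⟩
  b i + fires (σ i)  ≡⟨ balance-at-maximum ⟩
  a i                ∎
  where
  open ≡-Reasoning
  open AtMaximum adm balance maximal

gap-preserved-by-step : ∀ {a b i j} → Step a b → (∀ j → a j ≤ a i) →
  (a j + 2 ≤ a i → LApp a i ⊎ RApp a i) → a i ≤ a j + 2 → b i ≤ b j + 2
gap-preserved-by-step {a} {b} {i} {j} step maximal applicable gap
  with m≤n⇒m<n∨m≡n gap
... | inj₁ gap<2 = begin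
  b i          ≤⟨ maximum-does-not-grow step maximal ⟩
  a i          ≤⟨ s≤s⁻¹ (≤-trans gap<2 (≤-reflexive (+-suc (a j) 1))) ⟩
  a j + 1      ≤⟨ +-monoˡ-≤ 1 (loses-at-most-one step j) ⟩
  b j + 1 + 1  ≡⟨ +-assoc (b j) 1 1 ⟩
  b j + 2      ∎
  where open ≤-Reasoning
... | inj₂ gap≡2 = +-cancelʳ-≤ 1 (b i) (b j + 2) (begin
  b i + 1      ≡⟨ maximum-loses-if-applicable step maximal (applicable (≤-reflexive (sym gap≡2))) ⟩
  a i          ≡⟨ gap≡2 ⟩
  a j + 2      ≤⟨ +-monoˡ-≤ 2 (loses-at-most-one step j) ⟩
  b j + 1 + 2  ≡⟨ +-assoc (b j) 1 2 ⟩
  b j + 3      ≡⟨ +-assoc (b j) 2 1 ⟨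
  b j + 2 + 1  ∎)
  where open ≤-Reasoning

invariant-along-run : ∀ {P : ℕ → Set} k → P 0 → (∀ t → suc t < k → P t → P (suc t)) →
  ∀ t → t < k → P t
invariant-along-run k p₀ preserved zero    _   = p₀
invariant-along-run k p₀ preserved (suc t) t<k =
  preserved t t<k (invariant-along-run k p₀ preserved t (<-trans (n<1+n t) t<k))

lemma1 : (n k : ℕ) (c : ℕ → Config) (i : ℤ) →
    ((t : ℕ) → t < k → PSSPM n (c t)) →
    ((t : ℕ) → suc t < k → Step (c t) (c (suc t))) →
    ((t : ℕ) → t < k → (j : ℤ) → c t j ≤ c t i) →
    (c 0 i ≤ c 0 (i +ℤ + 1) + 2 →
    (t : ℕ) → t < k → c t i ≤ c t (i +ℤ + 1) + 2)
    ×
    (c 0 i ≤ c 0 (i -ℤ + 1) + 2 →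
    (t : ℕ) → t < k → c t i ≤ c t (i -ℤ + 1) + 2)
lemma1 n k c i _ step maximal = gap-persists (i +ℤ + 1) inj₂ , gap-persists (i -ℤ + 1) inj₁
  where
  gap-persists : (j : ℤ) → (∀ {a} → a j + 2 ≤ a i → LApp a i ⊎ RApp a i) →
    c 0 i ≤ c 0 j + 2 → (t : ℕ) → t < k → c t i ≤ c t j + 2
  gap-persists j applicable gap₀ = invariant-along-run k gap₀ λ t t+1<k →
    gap-preserved-by-step (step t t+1<k) (maximal t (<-trans (n<1+n t) t+1<k)) applicable
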